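{- For all permutations $\sigma\in\mathfrak S(n)$ and $\Pi\in\mathfrak S(N)$, $$\#\mathrm{RegMono}(\iota(\sigma),\iota(\Pi))=\#\{A\subseteq[N]:\ \mathrm{std}(\Pi|_A)=\sigma\}.$$
   Context: A finite strict double poset is a triple $(A,P_A,Q_A)$ with $A$ finite and $P_A,Q_A$ strict partial orders; morphisms are maps preserving both strict orders, forming a category; $\mathrm{RegMono}(d,D)$ is the set of regular monomorphisms (morphisms that are the equalizer of some parallel pair of morphisms). For $\sigma\in\mathfrak S(n)$, $\iota(\sigma)=([n],\{(i,j):i<j\},\{(i,j):\sigma(i)<\sigma(j)\})$. For $A=\{a_1<\dots<a_k\}\subseteq[N]$, $\mathrm{std}(\Pi|_A)\in\mathfrak S(k)$ is the permutation $\tau$ with $\tau(i)<\tau(j)\iff\Pi(a_i)<\Pi(a_j)$ (e.g. $\mathrm{std}([1\,5\,3\,2\,4]|_{\{2,3,5\}})=[3\,1\,2]$). -}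

module Defs where

open import Data.Nat using (ℕ)
open import Data.Bool using (Bool; T)
open import Data.Fin using (Fin; _<_; _<?_)
open import Data.Fin.Properties using (<-irrefl; <-trans)
open import Data.Fin.Permutation using (Permutation′; _⟨$⟩ʳ_)
open import Data.Fin.Subset using (Subset; _∈_)
open import Data.Vec using (Vec; lookup)
open import Data.List using (List; length)
import Data.List.Membership.Propositional as LM
open import Data.List.Relation.Unary.Unique.Propositional using (Unique)
open import Data.Product using (Σ; _×_; _,_; ∃)
open import Data.Empty using (⊥)
open import Relation.Nullary.Decidable using (⌊_⌋; toWitness; fromWitness)
open import Relation.Binary.PropositionalEquality using (_≡_; refl)
open import Function.Bundles using (_⇔_)

-- A finite strict double poset, with carrier represented (up to isomorphism) by Fin size,
-- and the two relations given as their (Bool-valued) characteristic functions.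
record DoublePoset : Set where
  field
    size   : ℕ
    P Q    : Fin size → Fin size → Bool
    P-irr  : ∀ i → T (P i i) → ⊥
    P-tr   : ∀ i j k → T (P i j) → T (P j k) → T (P i k)
    Q-irr  : ∀ i → T (Q i i) → ⊥
    Q-tr   : ∀ i j k → T (Q i j) → T (Q j k) → T (Q i k)
open DoublePoset public

Carrier : DoublePoset → Set
Carrier d = Fin (size d)

IsMor : (d D : DoublePoset) → (Carrier d → Carrier D) → Set
IsMor d D f =
  (∀ i j → T (P d i j) → T (P D (f i) (f j))) ×
  (∀ i j → T (Q d i j) → T (Q D (f i) (f j)))

IsEqualizer : (d D E : DoublePoset) → (Carrier d → Carrier D) →
              (g h : Carrier D → Carrier E) → Set
IsEqualizer d D E f g h =
  (∀ x → g (f x) ≡ h (f x)) ×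
  ((X : DoublePoset) (k : Carrier X → Carrier D) → IsMor X D k →
     (∀ x → g (k x) ≡ h (k x)) →
     Σ (Carrier X → Carrier d) λ u → IsMor X d u × (∀ x → f (u x) ≡ k x) ×
       ((u′ : Carrier X → Carrier d) → IsMor X d u′ → (∀ x → f (u′ x) ≡ k x) →
          ∀ x → u′ x ≡ u x))

IsRegMono : (d D : DoublePoset) → (Carrier d → Carrier D) → Set
IsRegMono d D f =
  IsMor d D f ×
  Σ DoublePoset λ E → Σ (Carrier D → Carrier E) λ g → Σ (Carrier D → Carrier E) λ h →
    IsMor D E g × IsMor D E h × IsEqualizer d D E f g h

private
  lt : ∀ {n} → Fin n → Fin n → Bool
  lt i j = ⌊ i <? j ⌋

  lt-irr : ∀ {n} (i : Fin n) → T (lt i i) → ⊥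
  lt-irr i p = <-irrefl refl (toWitness p)

  lt-tr : ∀ {n} (i j k : Fin n) → T (lt i j) → T (lt j k) → T (lt i k)
  lt-tr i j k p q = fromWitness (<-trans (toWitness p) (toWitness q))

ι : ∀ {n} → Permutation′ n → DoublePoset
ι {n} σ = record
  { size = n
  ; P = lt
  ; Q = λ i j → lt (σ ⟨$⟩ʳ i) (σ ⟨$⟩ʳ j)
  ; P-irr = lt-irr
  ; P-tr = lt-tr
  ; Q-irr = λ i → lt-irr (σ ⟨$⟩ʳ i)
  ; Q-tr = λ i j k → lt-tr (σ ⟨$⟩ʳ i) (σ ⟨$⟩ʳ j) (σ ⟨$⟩ʳ k)
  }

-- std(Π|_A) = σ : A = {a_1 < ... < a_n} (increasing enumeration e, e i = a_{i+1})
-- and σ(i) < σ(j) ⟺ Π(a_i) < Π(a_j)  (the defining property of std)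
StdEq : ∀ {n N} → Permutation′ N → Permutation′ n → Subset N → Set
StdEq {n} {N} Π σ A =
  Σ (Fin n → Fin N) λ e →
    (∀ i j → i < j → e i < e j) ×
    (∀ x → (x ∈ A) ⇔ ∃ λ i → e i ≡ x) ×
    (∀ i j → (σ ⟨$⟩ʳ i < σ ⟨$⟩ʳ j) ⇔ (Π ⟨$⟩ʳ e i < Π ⟨$⟩ʳ e j))

HasCard : ∀ {ℓ} {X : Set} → (X → Set ℓ) → ℕ → Set ℓ
HasCard {X = X} Pr k =
  Σ (List X) λ L → Unique L × (∀ x → (x LM.∈ L) ⇔ Pr x) × length L ≡ k

-- #RegMono(d, D), morphisms encoded as their value tables Vec (Carrier D) (size d)
RegMonoCard : (d D : DoublePoset) → ℕ → Set
RegMonoCard d D k = HasCard {X = Vec (Carrier D) (size d)} (λ v → IsRegMono d D (lookup v)) k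

{-# OPTIONS --safe #-}
-- A morphism ι σ → ι Π is strictly increasing, and since it preserves two strict total orders
-- it also reflects them: it is an embedding.  An embedding f : d → D is a regular monomorphism,
-- being the equalizer of the two maps D → D ⊔ D that agree exactly on the image of f.  So the
-- regular monomorphisms are just the morphisms.  A strictly increasing map is the increasing
-- enumeration of its image A, and being a morphism says precisely that std(Π|_A) = σ; hence
-- taking images is a bijection from morphisms onto the subsets A counted on the right.
module Submission where

open import Defs
open import Data.Nat using (ℕ; zero; suc; _+_)
open import Data.Nat.Properties using (<⇒≤)
open import Data.Product using (Σ; _×_; _,_; ∃; proj₁; proj₂)
open import Data.Product.Function.NonDependent.Propositional using (_×-⇔_)
open import Data.Sum using ([_,_]′)
open import Data.Fin using (Fin; _<_; _≤_; _<?_; _↑ˡ_; _↑ʳ_; splitAt)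
open import Data.Fin.Properties
  using (<-irrefl; <-asym; <-cmp; ≤-reflexive; ≤-antisym; any?; all?; _≟_; splitAt-↑ˡ; splitAt-↑ʳ)
open import Data.Fin.Induction using (<-wellFounded)
open import Data.Fin.Permutation using (Permutation′; _⟨$⟩ʳ_)
open import Data.Fin.Subset using (Subset)
import Data.Fin.Subset as Subset
open import Data.Fin.Subset.Properties using (⊆-antisym)
open import Data.Bool using (Bool; T)
open import Data.Bool.Properties using (T-≡)
open import Data.Vec using (Vec; []; _∷_; lookup; tabulate)
open import Data.Vec.Properties
  using (lookup∘tabulate; tabulate∘lookup; tabulate-cong; []=⇒lookup; lookup⇒[]=; ∷-injective)
open import Data.List using (List; map; filter; cartesianProductWith; allFin; length)
import Data.List as List
open import Data.List.Properties using (length-map)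
open import Data.List.Membership.Propositional using (_∈_)
open import Data.List.Membership.Propositional.Properties
  using (∈-cartesianProductWith⁺; ∈-allFin; ∈-filter⁺; ∈-filter⁻; ∈-map⁺; ∈-map⁻)
open import Data.List.Relation.Unary.Any using (here)
open import Data.List.Relation.Unary.All as All using (All)
open import Data.List.Relation.Unary.AllPairs as AllPairs using (AllPairs)
import Data.List.Relation.Unary.AllPairs.Properties as AllPairs
open import Data.List.Relation.Unary.Unique.Propositional using (Unique)
open import Data.List.Relation.Unary.Unique.Propositional.Properties
  using (cartesianProductWith⁺; allFin⁺; filter⁺)
open import Induction.WellFounded using (Acc; acc)
open import Relation.Nullary using (Dec; yes; no; contradiction)
open import Relation.Nullary.Decidable using (⌊_⌋; toWitness; fromWitness; _×-dec_; _→-dec_; T?)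
open import Relation.Unary using (Decidable)
open import Relation.Binary using (tri<; tri≈; tri>)
open import Relation.Binary.PropositionalEquality
  using (_≡_; _≢_; _≗_; refl; sym; trans; cong; subst; subst₂)
open import Function using (id; _∘_; Injective; Injection; _⇔_; mk⇔; Equivalence)
open import Function.Properties.Inverse using (↔⇒↣)
open import Function.Construct.Composition using (_⇔-∘_)
open Equivalence using (to; from)

private
  variable
    n N : ℕ
    A B : Set

IsMor-id : (D : DoublePoset) → IsMor D D id
IsMor-id D = (λ _ _ p → p) , (λ _ _ p → p)

IsMor-resp-≗ : ∀ d D {f g} → IsMor d D f → f ≗ g → IsMor d D g
IsMor-resp-≗ d D {f} {g} (presP , presQ) f≗g =
  (λ i j → along (P D) i j ∘ presP i j) , (λ i j → along (Q D) i j ∘ presQ i j)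
  where
  along : (R : Carrier D → Carrier D → Bool) → ∀ i j → T (R (f i) (f j)) → T (R (g i) (g j))
  along R i j = subst₂ (λ a b → T (R a b)) (f≗g i) (f≗g j)

record IsEmbedding (d D : DoublePoset) (f : Carrier d → Carrier D) : Set where
  field
    isMor     : IsMor d D f
    injective : Injective _≡_ _≡_ f
    reflectsP : ∀ i j → T (P D (f i) (f j)) → T (P d i j)
    reflectsQ : ∀ i j → T (Q D (f i) (f j)) → T (Q d i j)

IsMor-factor : ∀ {X d D f k u} → IsEmbedding d D f → IsMor X D k → (∀ x → f (u x) ≡ k x) →
               IsMor X d u
IsMor-factor {X} {D = D} {f} {u = u} emb k-mor f∘u≗k =
    (λ x y → reflectsP (u x) (u y) ∘ proj₁ f∘u-mor x y)
  , (λ x y → reflectsQ (u x) (u y) ∘ proj₂ f∘u-mor x y)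
  where
  open IsEmbedding emb
  f∘u-mor : IsMor X D (f ∘ u)
  f∘u-mor = IsMor-resp-≗ X D k-mor (sym ∘ f∘u≗k)

InImage : (Fin n → B) → B → Set
InImage f y = ∃ λ i → f i ≡ y

inImage? : (f : Fin n → Fin N) → Decidable (InImage f)
inImage? f y = any? (λ i → f i ≟ y)

↑ˡ≢↑ʳ : ∀ {m} (y z : Fin m) → y ↑ˡ m ≢ m ↑ʳ z
↑ˡ≢↑ʳ {m} y z eq
  with trans (sym (splitAt-↑ˡ m y m)) (trans (cong (splitAt m) eq) (splitAt-↑ʳ m m z))
... | ()

-- D ⊔ D on Fin (M + M), with both orders pulled back along the fold map.
module Doubling (D : DoublePoset) where

  private
    M = size D

  fold : Fin (M + M) → Carrier D
  fold = [ id , id ]′ ∘ splitAt M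

  doubled : DoublePoset
  doubled = record
    { size  = M + M
    ; P     = λ a b → P D (fold a) (fold b)
    ; Q     = λ a b → Q D (fold a) (fold b)
    ; P-irr = P-irr D ∘ fold
    ; P-tr  = λ a b c → P-tr D (fold a) (fold b) (fold c)
    ; Q-irr = Q-irr D ∘ fold
    ; Q-tr  = λ a b c → Q-tr D (fold a) (fold b) (fold c)
    }

  IsMor-section : (k : Carrier D → Fin (M + M)) → (∀ y → fold (k y) ≡ y) → IsMor D doubled k
  IsMor-section k fold∘k≗id = IsMor-resp-≗ D D (IsMor-id D) (sym ∘ fold∘k≗id)

  inl : Carrier D → Fin (M + M)
  inl y = y ↑ˡ M

  inlOn : {S : Carrier D → Set} → Decidable S → Carrier D → Fin (M + M)
  inlOn S? y with S? y
  ... | yes _ = inl y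
  ... | no  _ = M ↑ʳ y

  fold-inl : ∀ y → fold (inl y) ≡ y
  fold-inl y rewrite splitAt-↑ˡ M y M = refl

  fold-inlOn : ∀ {S : Carrier D → Set} (S? : Decidable S) y → fold (inlOn S? y) ≡ y
  fold-inlOn S? y with S? y
  ... | yes _ = fold-inl y
  ... | no  _ rewrite splitAt-↑ʳ M M y = refl

  inl≡inlOn⇔ : ∀ {S : Carrier D → Set} (S? : Decidable S) {y} → inl y ≡ inlOn S? y ⇔ S y
  inl≡inlOn⇔ S? {y} with S? y
  ... | yes s = mk⇔ (λ _ → s) (λ _ → refl)
  ... | no ¬s = mk⇔ (λ eq → contradiction eq (↑ˡ≢↑ʳ y y)) (λ s → contradiction s ¬s)

IsEmbedding⇒IsRegMono : ∀ {d D f} → IsEmbedding d D f → IsRegMono d D f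
IsEmbedding⇒IsRegMono {D = D} {f} emb =
  isMor , doubled , inl , inlOn (inImage? f) ,
  IsMor-section inl fold-inl , IsMor-section _ (fold-inlOn (inImage? f)) ,
  (λ x → from equalized⇔inImage (x , refl)) ,
  λ X k k-mor k-eq →
    let factor     = λ x → proj₁ (to equalized⇔inImage (k-eq x))
        f∘factor≗k = λ x → proj₂ (to equalized⇔inImage (k-eq x))
    in factor , IsMor-factor {X} emb k-mor f∘factor≗k , f∘factor≗k ,
       λ u _ f∘u≗k x → injective (trans (f∘u≗k x) (sym (f∘factor≗k x)))
  where
  open IsEmbedding emb
  open Doubling D
  equalized⇔inImage : ∀ {y} → inl y ≡ inlOn (inImage? f) y ⇔ InImage f y
  equalized⇔inImage = inl≡inlOn⇔ (inImage? f)

PreservesOrder : ∀ {m M} → (A → Fin m) → (B → Fin M) → (A → B) → Set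
PreservesOrder φ ψ f = ∀ i j → φ i < φ j → ψ (f i) < ψ (f j)

StrictlyIncreasing : (Fin n → Fin N) → Set
StrictlyIncreasing = PreservesOrder id id

PreservesOrder⇒reflects : ∀ {m M} (φ : A → Fin m) (ψ : B → Fin M) {f} → Injective _≡_ _≡_ φ →
                          PreservesOrder φ ψ f → ∀ i j → ψ (f i) < ψ (f j) → φ i < φ j
PreservesOrder⇒reflects φ ψ φ-inj pres i j ψfi<ψfj with <-cmp (φ i) (φ j)
... | tri< φi<φj _ _ = φi<φj
... | tri≈ _ φi≡φj _ rewrite φ-inj φi≡φj = contradiction ψfi<ψfj (<-irrefl refl)
... | tri> _ _ φj<φi = contradiction (pres j i φj<φi) (<-asym ψfi<ψfj)

StrictlyIncreasing⇒injective : ∀ {f : Fin n → Fin N} → StrictlyIncreasing f → Injective _≡_ _≡_ f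
StrictlyIncreasing⇒injective {f = f} inc {i} {j} fi≡fj with <-cmp i j
... | tri< i<j _ _ = contradiction (inc i j i<j) (<-irrefl fi≡fj)
... | tri≈ _ i≡j _ = i≡j
... | tri> _ _ j<i = contradiction (inc j i j<i) (<-irrefl (sym fi≡fj))

T-PreservesOrder⇔ : ∀ {m M} (φ : A → Fin m) (ψ : B → Fin M) {f} →
  (∀ i j → T ⌊ φ i <? φ j ⌋ → T ⌊ ψ (f i) <? ψ (f j) ⌋) ⇔ PreservesOrder φ ψ f
T-PreservesOrder⇔ φ ψ = mk⇔ (λ pres i j p → toWitness (pres i j (fromWitness p)))
                        (λ pres i j p → fromWitness (pres i j (toWitness p)))

image : (Fin n → Fin N) → Subset N
image f = tabulate (⌊_⌋ ∘ inImage? f)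

∈-image⇔ : ∀ {f : Fin n → Fin N} {x} → x Subset.∈ image f ⇔ InImage f x
∈-image⇔ {f = f} {x} = mk⇔
  (λ x∈ → toWitness {a? = inImage? f x}
             (from T-≡ (trans (sym (lookup∘tabulate _ x)) ([]=⇒lookup x∈))))
  (λ x∈ → lookup⇒[]= x (image f) (trans (lookup∘tabulate _ x) (to T-≡ (fromWitness x∈))))

image-unique : ∀ {f : Fin n → Fin N} {p} → (∀ x → x Subset.∈ p ⇔ InImage f x) → image f ≡ p
image-unique p⇔ = ⊆-antisym (from (p⇔ _) ∘ to ∈-image⇔) (from ∈-image⇔ ∘ to (p⇔ _))

image-cong : ∀ {f g : Fin n → Fin N} → f ≗ g → image f ≡ image g
image-cong f≗g = image-unique λ x →
  mk⇔ (λ x∈ → let (i , gi≡x) = to ∈-image⇔ x∈ in i , trans (f≗g i) gi≡x)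
      (λ (i , fi≡x) → from ∈-image⇔ (i , trans (sym (f≗g i)) fi≡x))

-- As e₁ and e₂ agree below i, the index at which e₁ takes the value e₂ i is at least i.
enumeration-≤ : ∀ {e₁ e₂ : Fin n → Fin N} {i} → StrictlyIncreasing e₁ → StrictlyIncreasing e₂ →
                (∀ {j} → j < i → e₁ j ≡ e₂ j) → InImage e₁ (e₂ i) → e₁ i ≤ e₂ i
enumeration-≤ {e₁ = e₁} {e₂} {i} inc₁ inc₂ agree (j , e₁j≡e₂i) with <-cmp j i
... | tri< j<i _ _ = contradiction (inc₂ j i j<i) (<-irrefl (trans (sym (agree j<i)) e₁j≡e₂i))
... | tri≈ _ refl _ = ≤-reflexive e₁j≡e₂i
... | tri> _ _ i<j = subst (e₁ i ≤_) e₁j≡e₂i (<⇒≤ (inc₁ i j i<j))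

image-injective : ∀ {e₁ e₂ : Fin n → Fin N} → StrictlyIncreasing e₁ → StrictlyIncreasing e₂ →
                  image e₁ ≡ image e₂ → e₁ ≗ e₂
image-injective {e₁ = e₁} {e₂} inc₁ inc₂ eq i = go i (<-wellFounded i)
  where
  values : ∀ {e e′ : Fin n → Fin N} → image e ≡ image e′ → ∀ i → InImage e′ (e i)
  values eq i = to ∈-image⇔ (subst (_ Subset.∈_) eq (from ∈-image⇔ (i , refl)))

  go : ∀ i → Acc _<_ i → e₁ i ≡ e₂ i
  go i (acc below) = ≤-antisym
    (enumeration-≤ inc₁ inc₂ agree (values (sym eq) i))
    (enumeration-≤ inc₂ inc₁ (sym ∘ agree) (values eq i))
    where
    agree : ∀ {j} → j < i → e₁ j ≡ e₂ j
    agree j<i = go _ (below j<i)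

module _ (σ : Permutation′ n) (Π : Permutation′ N) where

  IsMor-ι⇔ : ∀ {f} → IsMor (ι σ) (ι Π) f ⇔
                      (StrictlyIncreasing f × PreservesOrder (σ ⟨$⟩ʳ_) (Π ⟨$⟩ʳ_) f)
  IsMor-ι⇔ = T-PreservesOrder⇔ id id ×-⇔ T-PreservesOrder⇔ (σ ⟨$⟩ʳ_) (Π ⟨$⟩ʳ_)

  IsMor-ι⇒StrictlyIncreasing : ∀ {f} → IsMor (ι σ) (ι Π) f → StrictlyIncreasing f
  IsMor-ι⇒StrictlyIncreasing = proj₁ ∘ to IsMor-ι⇔

  IsMor-ι⇒reflects : ∀ {f} → IsMor (ι σ) (ι Π) f →
                     ∀ i j → Π ⟨$⟩ʳ f i < Π ⟨$⟩ʳ f j → σ ⟨$⟩ʳ i < σ ⟨$⟩ʳ j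
  IsMor-ι⇒reflects f-mor = PreservesOrder⇒reflects (σ ⟨$⟩ʳ_) (Π ⟨$⟩ʳ_)
    (Injection.injective (↔⇒↣ σ)) (proj₂ (to IsMor-ι⇔ f-mor))

  IsMor-ι⇒IsEmbedding : ∀ {f} → IsMor (ι σ) (ι Π) f → IsEmbedding (ι σ) (ι Π) f
  IsMor-ι⇒IsEmbedding f-mor = record
    { isMor     = f-mor
    ; injective = StrictlyIncreasing⇒injective inc
    ; reflectsP = λ i j p → fromWitness (PreservesOrder⇒reflects id id id inc i j (toWitness p))
    ; reflectsQ = λ i j p → fromWitness (IsMor-ι⇒reflects f-mor i j (toWitness p))
    }
    where inc = IsMor-ι⇒StrictlyIncreasing f-mor

  IsMor-ι⇔IsRegMono : ∀ f → IsMor (ι σ) (ι Π) f ⇔ IsRegMono (ι σ) (ι Π) f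
  IsMor-ι⇔IsRegMono f = mk⇔ (IsEmbedding⇒IsRegMono ∘ IsMor-ι⇒IsEmbedding) proj₁

  StdEq⇔ : ∀ {p} → StdEq Π σ p ⇔ (∃ λ e → IsMor (ι σ) (ι Π) e × image e ≡ p)
  StdEq⇔ = mk⇔
    (λ (e , inc , enum , order⇔) →
      e , from IsMor-ι⇔ (inc , λ i j → to (order⇔ i j)) , image-unique enum)
    (λ { (e , e-mor , refl) →
      e , IsMor-ι⇒StrictlyIncreasing e-mor , (λ _ → ∈-image⇔) ,
      λ i j → mk⇔ (proj₂ (to IsMor-ι⇔ e-mor) i j) (IsMor-ι⇒reflects e-mor i j) })

HasCard-cong : ∀ {Pr Pr′ : A → Set} {k} → (∀ x → Pr x ⇔ Pr′ x) → HasCard Pr k → HasCard Pr′ k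
HasCard-cong Pr⇔Pr′ (xs , xs-unique , ∈xs⇔ , len) =
  xs , xs-unique , (λ x → Pr⇔Pr′ x ⇔-∘ ∈xs⇔ x) , len

HasCard-filter : ∀ {Pr : A → Set} (Pr? : Decidable Pr) {xs} → Unique xs → (∀ x → x ∈ xs) →
                 HasCard Pr (length (filter Pr? xs))
HasCard-filter Pr? {xs} xs-unique ∈xs =
  _ , filter⁺ Pr? xs-unique ,
  (λ x → mk⇔ (proj₂ ∘ ∈-filter⁻ Pr? {xs = xs}) (∈-filter⁺ Pr? (∈xs x))) , refl

InjectiveOn : (A → Set) → (A → B) → Set
InjectiveOn Pr f = ∀ {x y} → Pr x → Pr y → f x ≡ f y → x ≡ y

Unique-map⁺-injectiveOn : ∀ {Pr : A → Set} {f : A → B} {xs} → InjectiveOn Pr f →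
                          All Pr xs → Unique xs → Unique (map f xs)
Unique-map⁺-injectiveOn {Pr = Pr} {f} f-inj all-Pr xs-unique =
  AllPairs.map⁺ (separate all-Pr xs-unique)
  where
  separate : ∀ {xs} → All Pr xs → Unique xs → AllPairs (λ x y → f x ≢ f y) xs
  separate All.[] AllPairs.[] = AllPairs.[]
  separate (px All.∷ pxs) (x∉xs AllPairs.∷ xs-unique) =
    All.zipWith (λ (py , x≢y) → x≢y ∘ f-inj px py) (pxs , x∉xs) AllPairs.∷ separate pxs xs-unique

HasCard-map : ∀ {Pr : A → Set} {Pr′ : B → Set} {k} (f : A → B) → InjectiveOn Pr f →
              (∀ y → Pr′ y ⇔ ∃ λ x → Pr x × f x ≡ y) → HasCard Pr k → HasCard Pr′ k
HasCard-map {Pr′ = Pr′} f f-inj Pr′⇔ (xs , xs-unique , ∈xs⇔ , refl) =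
    map f xs
  , Unique-map⁺-injectiveOn f-inj (All.tabulate (to (∈xs⇔ _))) xs-unique
  , ∈map⇔
  , length-map f xs
  where
  ∈map⇔ : ∀ y → y ∈ map f xs ⇔ Pr′ y
  ∈map⇔ y = mk⇔
    (λ y∈ → let (x , x∈ , y≡fx) = ∈-map⁻ f y∈ in from (Pr′⇔ y) (x , to (∈xs⇔ x) x∈ , sym y≡fx))
    (λ Pr′y → let (x , Prx , fx≡y) = to (Pr′⇔ y) Pr′y
              in subst (_∈ map f xs) fx≡y (∈-map⁺ f (from (∈xs⇔ x) Prx)))

allVec : ∀ N n → List (Vec (Fin N) n)
allVec N zero    = List.[ [] ]
allVec N (suc n) = cartesianProductWith _∷_ (allFin N) (allVec N n)

Unique-allVec : ∀ N n → Unique (allVec N n)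
Unique-allVec N zero    = All.[] AllPairs.∷ AllPairs.[]
Unique-allVec N (suc n) = cartesianProductWith⁺ _∷_ ∷-injective (allFin⁺ N) (Unique-allVec N n)

∈-allVec : (v : Vec (Fin N) n) → v ∈ allVec N n
∈-allVec []      = here refl
∈-allVec (x ∷ v) = ∈-cartesianProductWith⁺ _∷_ (∈-allFin x) (∈-allVec v)

∃-tabulate⇔ : {Pr : (Fin n → A) → Set} → (∀ {f g} → f ≗ g → Pr f → Pr g) →
              (∃ λ f → Pr f) ⇔ (∃ λ v → Pr (lookup v))
∃-tabulate⇔ Pr-resp = mk⇔ (λ (f , Prf) → tabulate f , Pr-resp (sym ∘ lookup∘tabulate f) Prf)
                          (λ (v , Prv) → lookup v , Prv)

lookup-≗⇒≡ : {xs ys : Vec A n} → lookup xs ≗ lookup ys → xs ≡ ys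
lookup-≗⇒≡ {xs = xs} {ys} eq =
  trans (sym (tabulate∘lookup xs)) (trans (tabulate-cong eq) (tabulate∘lookup ys))

isMor? : ∀ d D (f : Carrier d → Carrier D) → Dec (IsMor d D f)
isMor? d D f = preserves? (P d) (P D) ×-dec preserves? (Q d) (Q D)
  where
  preserves? : ∀ R S → Dec (∀ i j → T (R i j) → T (S (f i) (f j)))
  preserves? R S = all? λ i → all? λ j → T? (R i j) →-dec T? (S (f i) (f j))

lemma3p7 : (n N : ℕ) (σ : Permutation′ n) (Π : Permutation′ N) →
    Σ ℕ λ k → RegMonoCard (ι σ) (ι Π) k × HasCard (StdEq Π σ) k
lemma3p7 n N σ Π =
  _ , HasCard-cong (IsMor-ι⇔IsRegMono σ Π ∘ lookup) morphisms
    , HasCard-map (image ∘ lookup) image-injectiveᵥ StdEq⇔∃vec morphisms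
  where
  IsMorᵥ : Vec (Fin N) n → Set
  IsMorᵥ v = IsMor (ι σ) (ι Π) (lookup v)

  isMorᵥ? : Decidable IsMorᵥ
  isMorᵥ? = isMor? (ι σ) (ι Π) ∘ lookup

  morphisms : HasCard IsMorᵥ (length (filter isMorᵥ? (allVec N n)))
  morphisms = HasCard-filter isMorᵥ? (Unique-allVec N n) ∈-allVec

  image-injectiveᵥ : InjectiveOn IsMorᵥ (image ∘ lookup)
  image-injectiveᵥ u-mor v-mor =
    lookup-≗⇒≡ ∘ image-injective (IsMor-ι⇒StrictlyIncreasing σ Π u-mor)
                                 (IsMor-ι⇒StrictlyIncreasing σ Π v-mor)

  StdEq⇔∃vec : ∀ p → StdEq Π σ p ⇔ ∃ λ v → IsMorᵥ v × image (lookup v) ≡ p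
  StdEq⇔∃vec p = ∃-tabulate⇔ resp ⇔-∘ StdEq⇔ σ Π
    where
    resp : ∀ {f g} → f ≗ g → IsMor (ι σ) (ι Π) f × image f ≡ p → IsMor (ι σ) (ι Π) g × image g ≡ p
    resp f≗g (f-mor , image-f≡p) =
      IsMor-resp-≗ (ι σ) (ι Π) f-mor f≗g , trans (sym (image-cong f≗g)) image-f≡p
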